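{- Let $k>1$ be an integer. For $1\le i\le k$ let $N_i=\binom{k-1}{i-1}$ and let $T^k_i=(t^k_i(p,q))_{1\le p,q\le N_i}$ be the $N_i\times N_i$ $0/1$-matrix defined as follows: let $A(1),\dots,A(N_i)$ be the compositions $(a_1,\dots,a_i)$ of $k+1$ into $i$ positive parts with $a_1\ge 2$, and $B(1),\dots,B(N_i)$ the compositions $(b_1,\dots,b_i)$ of $k$ into $i$ positive parts, each list in descending lexicographic order; set $t^k_i(p,q)=1$ if $\sum_{j=1}^{h}(a_j(p)-b_j(q))>0$ for all $h=1,\dots,i$, and $t^k_i(p,q)=0$ otherwise. Then for every $\ell$ with $1\le \ell\le k$, the matrices $T^k_\ell$ and $T^k_{k+1-\ell}$ (both of size $N=N_\ell=N_{k+1-\ell}$) are anti-transpose, i.e. $t^k_\ell(p,q)=t^k_{k+1-\ell}(N+1-q,\,N+1-p)$ for all $1\le p,q\le N$. In particular, if $\ell=\frac{k+1}{2}$ is an even integer, then $T^k_\ell$ is anti-symmetric, i.e. $t^k_\ell(p,q)=t^k_\ell(N+1-q,N+1-p)$ for all $1\le p,q\le N$.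
   Context: A composition of a positive integer $n$ into $i$ parts is an ordered $i$-tuple of positive integers with sum $n$; $A(p)=(a_1(p),\dots,a_i(p))$ and $B(q)=(b_1(q),\dots,b_i(q))$ denote the $p$-th and $q$-th compositions in the respective lists. Two $N\times N$ matrices $(t_{p,q})$ and $(s_{p,q})$ are anti-transpose if $t_{p,q}=s_{N+1-q,N+1-p}$ for all $p,q$; a square matrix is anti-symmetric if it is anti-transpose of itself. -}

module Defs where

open import Data.Nat using (ℕ; zero; suc; _+_; _∸_; _≤_; _<_; _<ᵇ_)
open import Data.Bool using (Bool; true; false; _∧_)
open import Data.List using (List; []; _∷_; map; concatMap; filter; length)
open import Data.Integer as ℤ using (ℤ; +_; _-_)
open import Relation.Nullary.Decidable using (yes; no; does)
import Data.Nat as ℕ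

downFrom1 : ℕ → List ℕ
downFrom1 zero = []
downFrom1 (suc n) = suc n ∷ downFrom1 n

compositions : ℕ → ℕ → List (List ℕ)
compositions zero zero = [] ∷ []
compositions (suc n) zero = []
compositions zero (suc zero) = []
compositions (suc m) (suc zero) = (suc m ∷ []) ∷ []
compositions n (suc (suc i)) =
  concatMap (λ a → map (a ∷_) (compositions (n ∸ a) (suc i))) (downFrom1 (n ∸ suc i))

firstAtLeast2 : List ℕ → Bool
firstAtLeast2 [] = false
firstAtLeast2 (a ∷ _) = 1 <ᵇ a

Alist : ℕ → ℕ → List (List ℕ)
Alist k i = filter (λ c → Relation.Nullary.Decidable.Core.T? (firstAtLeast2 c)) (compositions (suc k) i)
  where import Relation.Nullary.Decidable.Core

Blist : ℕ → ℕ → List (List ℕ)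
Blist k i = compositions k i

-- 1-based lookup with a default (the default is never used for 1 ≤ p ≤ N_i)
nth1 : {A : Set} → A → List A → ℕ → A
nth1 d [] _ = d
nth1 d (x ∷ xs) zero = d
nth1 d (x ∷ xs) (suc zero) = x
nth1 d (x ∷ xs) (suc (suc p)) = nth1 d xs (suc p)

allPartialPos : ℤ → List ℕ → List ℕ → Bool
allPartialPos acc (a ∷ as) (b ∷ bs) =
  let s = acc ℤ.+ ((+ a) - (+ b)) in does (ℤ.0ℤ ℤ.<? s) ∧ allPartialPos s as bs
allPartialPos acc _ _ = true

t : ℕ → ℕ → ℕ → ℕ → ℕ
t k i p q with allPartialPos ℤ.0ℤ (nth1 [] (Alist k i) p) (nth1 [] (Blist k i) q)
... | true = 1
... | false = 0

-- A composition of n + 1 into r + 1 parts is a word of length n with r letters true,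
-- a true at position j meaning that a part ends at j; descending lexicographic order of
-- compositions becomes ascending order of words (false < true), and the compositions with
-- first part at least 2 are obtained by adding 1 to the first part. Partial sums of a
-- composition are the positions of the trues of its word, so t(p, q) = 1 says that every
-- prefix of the p-th word has at most as many trues as the equally long prefix of the q-th.
-- Complementing both words and swapping them preserves this condition, and complementing
-- reverses the list of words while turning r trues into n − r trues: this is the
-- anti-transposition. Anti-symmetry is the case r = n − r.
module Submission where

open import Defs
open import Data.Nat using (ℕ; suc; _∸_; _+_; _≤_; _<_; _*_)
open import Data.Nat.Combinatorics using (_C_)
open import Data.Product using (_×_)
open import Relation.Binary.PropositionalEquality using (_≡_)

open import Data.Bool using (Bool; true; false; not; _∧_; T; if_then_else_)
open import Data.Integer as ℤ using (+_; _-_; 0ℤ)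
import Data.Integer.Properties as ℤP
open import Data.Integer.Solver using (module +-*-Solver)
open import Data.List
  using (List; []; _∷_; _++_; _∷ʳ_; map; concatMap; filter; length; reverse)
import Data.List.Properties as List
open import Data.List.Relation.Unary.All as All using (All; []; _∷_)
import Data.List.Relation.Unary.All.Properties as All
open import Data.Nat as ℕ using (zero; _<ᵇ_; z≤n; s≤s)
import Data.Nat.Properties as ℕP
open import Data.Nat.Combinatorics using (nCk≡nC[n∸k]; nCk+nC[k+1]≡[n+1]C[k+1])
open import Data.Nat.Combinatorics.Specification using (k>n⇒nCk≡0)
open import Data.Product using (_,_; proj₁; proj₂)
open import Data.Sum using (_⊎_; inj₁; inj₂)
open import Function using (_∘_; _⇔_; mk⇔; Equivalence)
open import Relation.Nullary.Decidable using (does; yes; no; dec-true; dec-false; does-⇔)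
open import Relation.Nullary.Decidable.Core using (T?)
open import Relation.Unary using (Decidable)
open import Relation.Binary.PropositionalEquality
  using (refl; sym; trans; cong; cong₂; subst; module ≡-Reasoning)
open ≡-Reasoning

<ᵇ-true : ∀ {m n} → m < n → (m <ᵇ n) ≡ true
<ᵇ-true {m} {n} = dec-true (m ℕ.<? n)

<ᵇ-false : ∀ {m n} → n ≤ m → (m <ᵇ n) ≡ false
<ᵇ-false {m} {n} n≤m = dec-false (m ℕ.<? n) (ℕP.≤⇒≯ n≤m)

0<i-j⇔j<i : ∀ {i j} → 0ℤ ℤ.< i - j ⇔ j ℤ.< i
0<i-j⇔j<i = mk⇔
  (λ 0<i-j → ℤP.≰⇒> (λ i≤j → ℤP.<⇒≱ 0<i-j (ℤP.i≤j⇒i-j≤0 i≤j)))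
  (λ j<i → ℤP.≰⇒> (λ i-j≤0 → ℤP.<⇒≱ j<i (ℤP.i-j≤0⇒i≤j i-j≤0)))

does-0<m-n : ∀ m n → does (0ℤ ℤ.<? (+ m - + n)) ≡ (n <ᵇ m)
does-0<m-n m n = does-⇔ 0<m-n⇔n<m (0ℤ ℤ.<? (+ m - + n)) (n ℕ.<? m)
  where
  open Equivalence (0<i-j⇔j<i {+ m} {+ n})
  0<m-n⇔n<m : 0ℤ ℤ.< + m - + n ⇔ n < m
  0<m-n⇔n<m = mk⇔ (ℤP.drop‿+<+ ∘ to) (from ∘ ℤ.+<+)

prefixSums : ℕ → List ℕ → List ℕ
prefixSums s []       = []
prefixSums s (x ∷ xs) = s + x ∷ prefixSums (s + x) xs

-- Compares the lists only up to the length of the shorter one, as allPartialPos does.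
pointwise<ᵇ : List ℕ → List ℕ → Bool
pointwise<ᵇ _        []       = true
pointwise<ᵇ []       (_ ∷ _)  = true
pointwise<ᵇ (x ∷ xs) (y ∷ ys) = (x <ᵇ y) ∧ pointwise<ᵇ xs ys

+m-+n+[+x-+y] : ∀ m n x y → (+ m - + n) ℤ.+ (+ x - + y) ≡ + (m + x) - + (n + y)
+m-+n+[+x-+y] m n x y = solve 4 (λ m n x y → (m :- n) :+ (x :- y) := (m :+ x) :- (n :+ y))
  refl (+ m) (+ n) (+ x) (+ y)
  where open +-*-Solver

allPartialPos≡pointwise<ᵇ : ∀ m n xs ys →
  allPartialPos (+ m - + n) xs ys ≡ pointwise<ᵇ (prefixSums n ys) (prefixSums m xs)
allPartialPos≡pointwise<ᵇ m n []       []       = refl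
allPartialPos≡pointwise<ᵇ m n []       (_ ∷ _)  = refl
allPartialPos≡pointwise<ᵇ m n (_ ∷ _)  []       = refl
allPartialPos≡pointwise<ᵇ m n (x ∷ xs) (y ∷ ys)
  rewrite +m-+n+[+x-+y] m n x y | does-0<m-n (m + x) (n + y)
  = cong ((n + y <ᵇ m + x) ∧_) (allPartialPos≡pointwise<ᵇ (m + x) (n + y) xs ys)

-- composition x w is the composition encoded by w, with x added to its first part.
composition : ℕ → List Bool → List ℕ
composition x []          = suc x ∷ []
composition x (false ∷ w) = composition (suc x) w
composition x (true ∷ w)  = suc x ∷ composition 0 w

-- cutPoints i w lists the positions of the trues of w, and then suc (i + length w),
-- where positions are counted from i + 1.
cutPoints : ℕ → List Bool → List ℕ
cutPoints i []          = suc i ∷ []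
cutPoints i (false ∷ w) = cutPoints (suc i) w
cutPoints i (true ∷ w)  = suc i ∷ cutPoints (suc i) w

prefixSums-composition : ∀ s x w → prefixSums s (composition x w) ≡ cutPoints (s + x) w
prefixSums-composition s x [] rewrite ℕP.+-suc s x = refl
prefixSums-composition s x (false ∷ w) =
  trans (prefixSums-composition s (suc x) w) (cong (λ i → cutPoints i w) (ℕP.+-suc s x))
prefixSums-composition s x (true ∷ w) rewrite ℕP.+-suc s x =
  cong (suc (s + x) ∷_)
    (trans (prefixSums-composition (suc (s + x)) 0 w)
           (cong (λ i → cutPoints i w) (ℕP.+-identityʳ _)))

-- dominated d u v: every prefix of u has at most d more trues than the prefix of v of the
-- same length.
dominated : ℕ → List Bool → List Bool → Bool
dominated d       (false ∷ u) (false ∷ v) = dominated d u v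
dominated d       (true ∷ u)  (true ∷ v)  = dominated d u v
dominated d       (false ∷ u) (true ∷ v)  = dominated (suc d) u v
dominated zero    (true ∷ u)  (false ∷ v) = false
dominated (suc d) (true ∷ u)  (false ∷ v) = dominated d u v
dominated _       _           _           = true

complement : List Bool → List Bool
complement = map not

dominated-complement : ∀ d u v → dominated d u v ≡ dominated d (complement v) (complement u)
dominated-complement d       []          []          = refl
dominated-complement d       []          (false ∷ v) = refl
dominated-complement d       []          (true ∷ v)  = refl
dominated-complement d       (false ∷ u) []          = refl
dominated-complement d       (true ∷ u)  []          = refl
dominated-complement d       (false ∷ u) (false ∷ v) = dominated-complement d u v
dominated-complement d       (true ∷ u)  (true ∷ v)  = dominated-complement d u v
dominated-complement d       (false ∷ u) (true ∷ v)  = dominated-complement (suc d) u v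
dominated-complement zero    (true ∷ u)  (false ∷ v) = refl
dominated-complement (suc d) (true ∷ u)  (false ∷ v) = dominated-complement d u v

pointwise<ᵇ-cutPoints : ∀ j v {k ys} → k ≤ suc j → pointwise<ᵇ (cutPoints j v) (k ∷ ys) ≡ false
pointwise<ᵇ-cutPoints j []          k≤1+j rewrite <ᵇ-false k≤1+j = refl
pointwise<ᵇ-cutPoints j (false ∷ v) k≤1+j = pointwise<ᵇ-cutPoints (suc j) v (ℕP.m≤n⇒m≤1+n k≤1+j)
pointwise<ᵇ-cutPoints j (true ∷ v)  k≤1+j rewrite <ᵇ-false k≤1+j = refl

-- The list ps holds the cut points of v that are not yet matched by a cut point of u; they all
-- lie below the cut points still to come from u.
dominated≡pointwise<ᵇ : ∀ i ps u v → All (_≤ suc i) ps → length u ≡ length v →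
  dominated (length ps) u v ≡ pointwise<ᵇ (ps ++ cutPoints i v) (cutPoints (suc i) u)
dominated-suc≡pointwise<ᵇ : ∀ i ps u v → All (_≤ suc i) ps → length u ≡ length v →
  dominated (suc (length ps)) u v
    ≡ pointwise<ᵇ (ps ++ suc i ∷ cutPoints (suc i) v) (cutPoints (suc (suc i)) u)

dominated≡pointwise<ᵇ i [] [] [] _ _ rewrite <ᵇ-true (ℕP.n<1+n (suc i)) = refl
dominated≡pointwise<ᵇ i (p ∷ ps) [] [] (p≤ ∷ _) _ rewrite <ᵇ-true (s≤s p≤) = refl
dominated≡pointwise<ᵇ i ps (false ∷ u) (false ∷ v) ps≤ eq =
  dominated≡pointwise<ᵇ (suc i) ps u v (All.map ℕP.m≤n⇒m≤1+n ps≤) (ℕP.suc-injective eq)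
dominated≡pointwise<ᵇ i [] (true ∷ u) (true ∷ v) _ eq rewrite <ᵇ-true (ℕP.n<1+n (suc i)) =
  dominated≡pointwise<ᵇ (suc i) [] u v [] (ℕP.suc-injective eq)
dominated≡pointwise<ᵇ i (p ∷ ps) (true ∷ u) (true ∷ v) (p≤ ∷ ps≤) eq rewrite <ᵇ-true (s≤s p≤) =
  dominated-suc≡pointwise<ᵇ i ps u v ps≤ (ℕP.suc-injective eq)
dominated≡pointwise<ᵇ i ps (false ∷ u) (true ∷ v) ps≤ eq =
  dominated-suc≡pointwise<ᵇ i ps u v ps≤ (ℕP.suc-injective eq)
dominated≡pointwise<ᵇ i [] (true ∷ u) (false ∷ v) _ _ =
  sym (pointwise<ᵇ-cutPoints (suc i) v ℕP.≤-refl)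
dominated≡pointwise<ᵇ i (p ∷ ps) (true ∷ u) (false ∷ v) (p≤ ∷ ps≤) eq rewrite <ᵇ-true (s≤s p≤) =
  dominated≡pointwise<ᵇ (suc i) ps u v (All.map ℕP.m≤n⇒m≤1+n ps≤) (ℕP.suc-injective eq)
dominated≡pointwise<ᵇ i ps []      (_ ∷ _) _ ()
dominated≡pointwise<ᵇ i ps (_ ∷ _) []      _ ()

dominated-suc≡pointwise<ᵇ i ps u v ps≤ eq = begin
  dominated (suc (length ps)) u v
    ≡⟨ cong (λ d → dominated d u v) length-∷ʳ ⟨
  dominated (length (ps ∷ʳ suc i)) u v
    ≡⟨ dominated≡pointwise<ᵇ (suc i) (ps ∷ʳ suc i) u v
         (All.∷ʳ⁺ (All.map ℕP.m≤n⇒m≤1+n ps≤) (ℕP.n≤1+n (suc i))) eq ⟩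
  pointwise<ᵇ ((ps ∷ʳ suc i) ++ cutPoints (suc i) v) (cutPoints (suc (suc i)) u)
    ≡⟨ cong (λ xs → pointwise<ᵇ xs (cutPoints (suc (suc i)) u)) (List.∷ʳ-++ ps (suc i) _) ⟩
  pointwise<ᵇ (ps ++ suc i ∷ cutPoints (suc i) v) (cutPoints (suc (suc i)) u) ∎
  where
  length-∷ʳ : length (ps ∷ʳ suc i) ≡ suc (length ps)
  length-∷ʳ = trans (List.length-++ ps) (ℕP.+-comm (length ps) 1)

allPartialPos-composition≡dominated : ∀ u v → length u ≡ length v →
  allPartialPos 0ℤ (composition 1 u) (composition 0 v) ≡ dominated 0 u v
allPartialPos-composition≡dominated u v eq = begin
  allPartialPos 0ℤ (composition 1 u) (composition 0 v)
    ≡⟨ allPartialPos≡pointwise<ᵇ 0 0 (composition 1 u) (composition 0 v) ⟩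
  pointwise<ᵇ (prefixSums 0 (composition 0 v)) (prefixSums 0 (composition 1 u))
    ≡⟨ cong₂ pointwise<ᵇ (prefixSums-composition 0 0 v) (prefixSums-composition 0 1 u) ⟩
  pointwise<ᵇ (cutPoints 0 v) (cutPoints 1 u)
    ≡⟨ dominated≡pointwise<ᵇ 0 [] u v [] eq ⟨
  dominated 0 u v ∎

incHead : List ℕ → List ℕ
incHead []       = []
incHead (x ∷ xs) = suc x ∷ xs

downFrom1-suc : ∀ m → downFrom1 (suc m) ≡ map suc (downFrom1 m) ++ 1 ∷ []
downFrom1-suc zero    = refl
downFrom1-suc (suc m) = cong (suc (suc m) ∷_) (downFrom1-suc m)

compositions-empty : ∀ n j → n ≤ j → compositions n (suc j) ≡ []
compositions-empty zero    zero    _   = refl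
compositions-empty zero    (suc j) _   = refl
compositions-empty (suc n) (suc j) n≤j rewrite ℕP.m≤n⇒m∸n≡0 n≤j = refl

compositions-suc : ∀ n i → compositions (suc n) (suc i)
  ≡ map incHead (compositions n (suc i)) ++ map (1 ∷_) (compositions n i)
compositions-suc zero    zero          = refl
compositions-suc zero    (suc zero)    = refl
compositions-suc zero    (suc (suc j)) = refl
compositions-suc (suc n) zero          = refl
compositions-suc (suc n) (suc j) with j ℕ.≤? n
... | no j≰n
  rewrite ℕP.m≤n⇒m∸n≡0 (ℕP.≰⇒> j≰n) | ℕP.m≤n⇒m∸n≡0 (ℕP.<⇒≤ (ℕP.≰⇒> j≰n))
        | compositions-empty (suc n) j (ℕP.≰⇒> j≰n) = refl
... | yes j≤n = begin
  concatMap f (downFrom1 (suc n ∸ j))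
    ≡⟨ cong (concatMap f ∘ downFrom1) (ℕP.+-∸-assoc 1 j≤n) ⟩
  concatMap f (downFrom1 (suc (n ∸ j)))
    ≡⟨ cong (concatMap f) (downFrom1-suc (n ∸ j)) ⟩
  concatMap f (map suc (downFrom1 (n ∸ j)) ++ 1 ∷ [])
    ≡⟨ List.concatMap-++ f (map suc (downFrom1 (n ∸ j))) (1 ∷ []) ⟩
  concatMap f (map suc (downFrom1 (n ∸ j))) ++ f 1 ++ []
    ≡⟨ cong₂ _++_ (List.concatMap-map f suc (downFrom1 (n ∸ j))) (List.++-identityʳ (f 1)) ⟩
  concatMap (f ∘ suc) (downFrom1 (n ∸ j)) ++ f 1
    ≡⟨ cong (_++ f 1) (List.concatMap-cong (λ a → List.map-∘ (compositions (suc n ∸ a) (suc j)))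
                                            (downFrom1 (n ∸ j))) ⟩
  concatMap (map incHead ∘ g) (downFrom1 (n ∸ j)) ++ f 1
    ≡⟨ cong (_++ f 1) (List.map-concatMap incHead g (downFrom1 (n ∸ j))) ⟨
  map incHead (concatMap g (downFrom1 (n ∸ j))) ++ f 1 ∎
  where
  f g : ℕ → List (List ℕ)
  f a = map (a ∷_) (compositions (suc (suc n) ∸ a) (suc j))
  g a = map (a ∷_) (compositions (suc n ∸ a) (suc j))

words : ℕ → ℕ → List (List Bool)
words zero    zero    = [] ∷ []
words zero    (suc r) = []
words (suc n) zero    = map (false ∷_) (words n zero)
words (suc n) (suc r) = map (false ∷_) (words n (suc r)) ++ map (true ∷_) (words n r)

words-empty : ∀ {n r} → n < r → words n r ≡ []
words-empty {zero}  {suc r} _ = refl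
words-empty {suc n} {suc r} (s≤s n<r)
  rewrite words-empty (ℕP.m<n⇒m<1+n n<r) | words-empty n<r = refl

length-words : ∀ n r → length (words n r) ≡ n C r
length-words zero    zero    = refl
length-words zero    (suc r) = sym (k>n⇒nCk≡0 {0} {suc r} (s≤s z≤n))
length-words (suc n) zero    = trans (List.length-map _ (words n zero)) (length-words n zero)
length-words (suc n) (suc r) = begin
  length (map (false ∷_) (words n (suc r)) ++ map (true ∷_) (words n r))
    ≡⟨ List.length-++ (map (false ∷_) (words n (suc r))) ⟩
  length (map (false ∷_) (words n (suc r))) + length (map (true ∷_) (words n r))
    ≡⟨ cong₂ _+_ (List.length-map _ (words n (suc r))) (List.length-map _ (words n r)) ⟩
  length (words n (suc r)) + length (words n r)
    ≡⟨ cong₂ _+_ (length-words n (suc r)) (length-words n r) ⟩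
  n C suc r + n C r
    ≡⟨ ℕP.+-comm (n C suc r) (n C r) ⟩
  n C r + n C suc r
    ≡⟨ nCk+nC[k+1]≡[n+1]C[k+1] n r ⟩
  suc n C suc r ∎

length-∈-words : ∀ n r → All (λ w → length w ≡ n) (words n r)
length-∈-words zero    zero    = refl ∷ []
length-∈-words zero    (suc r) = []
length-∈-words (suc n) zero    = All.map⁺ (All.map (cong suc) (length-∈-words n zero))
length-∈-words (suc n) (suc r) = All.++⁺ (All.map⁺ (All.map (cong suc) (length-∈-words n (suc r))))
                                          (All.map⁺ (All.map (cong suc) (length-∈-words n r)))

mirror : List (List Bool) → List (List Bool)
mirror ws = reverse (map complement ws)

mirror-++ : ∀ ws ws′ → mirror (ws ++ ws′) ≡ mirror ws′ ++ mirror ws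
mirror-++ ws ws′ =
  trans (cong reverse (List.map-++ complement ws ws′)) (List.reverse-++ (map complement ws) _)

mirror-map-∷ : ∀ b ws → mirror (map (b ∷_) ws) ≡ map (not b ∷_) (mirror ws)
mirror-map-∷ b ws = begin
  reverse (map complement (map (b ∷_) ws))     ≡⟨ cong reverse (List.map-∘ ws) ⟨
  reverse (map ((not b ∷_) ∘ complement) ws)   ≡⟨ cong reverse (List.map-∘ ws) ⟩
  reverse (map (not b ∷_) (map complement ws)) ≡⟨ List.reverse-map (not b ∷_) (map complement ws) ⟨
  map (not b ∷_) (mirror ws)                   ∎

mirror-words : ∀ n r → r ≤ n → mirror (words n r) ≡ words n (n ∸ r)
mirror-words zero    zero    _ = refl
mirror-words (suc n) zero    _ = begin
  mirror (map (false ∷_) (words n 0))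
    ≡⟨ mirror-map-∷ false (words n 0) ⟩
  map (true ∷_) (mirror (words n 0))
    ≡⟨ cong (map (true ∷_)) (mirror-words n 0 z≤n) ⟩
  map (true ∷_) (words n n)
    ≡⟨ cong (λ ws → map (false ∷_) ws ++ map (true ∷_) (words n n)) (words-empty (ℕP.n<1+n n)) ⟨
  words (suc n) (suc n) ∎
mirror-words (suc n) (suc r) (s≤s r≤n) = begin
  mirror (map (false ∷_) (words n (suc r)) ++ map (true ∷_) (words n r))
    ≡⟨ mirror-++ (map (false ∷_) (words n (suc r))) _ ⟩
  mirror (map (true ∷_) (words n r)) ++ mirror (map (false ∷_) (words n (suc r)))
    ≡⟨ cong₂ _++_ (mirror-map-∷ true (words n r)) (mirror-map-∷ false (words n (suc r))) ⟩
  map (false ∷_) (mirror (words n r)) ++ map (true ∷_) (mirror (words n (suc r)))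
    ≡⟨ cong (λ ws → map (false ∷_) ws ++ map (true ∷_) (mirror (words n (suc r))))
            (mirror-words n r r≤n) ⟩
  map (false ∷_) (words n (n ∸ r)) ++ map (true ∷_) (mirror (words n (suc r)))
    ≡⟨ words-suc-n∸r (ℕP.m≤n⇒m<n∨m≡n r≤n) ⟩
  words (suc n) (n ∸ r) ∎
  where
  words-suc-n∸r : r < n ⊎ r ≡ n →
    map (false ∷_) (words n (n ∸ r)) ++ map (true ∷_) (mirror (words n (suc r)))
      ≡ words (suc n) (n ∸ r)
  words-suc-n∸r (inj₁ r<n) rewrite mirror-words n (suc r) r<n | ℕP.+-∸-assoc 1 r<n = refl
  words-suc-n∸r (inj₂ refl) rewrite ℕP.n∸n≡0 n | words-empty (ℕP.n<1+n n) = List.++-identityʳ _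

incHead-composition : ∀ x w → incHead (composition x w) ≡ composition (suc x) w
incHead-composition x []          = refl
incHead-composition x (false ∷ w) = incHead-composition (suc x) w
incHead-composition x (true ∷ w)  = refl

map-incHead-composition : ∀ x ws →
  map incHead (map (composition x) ws) ≡ map (composition (suc x)) ws
map-incHead-composition x ws =
  trans (sym (List.map-∘ ws)) (List.map-cong (incHead-composition x) ws)

map-composition-false : ∀ ws →
  map (composition 0) (map (false ∷_) ws) ≡ map incHead (map (composition 0) ws)
map-composition-false ws = trans (sym (List.map-∘ ws)) (sym (map-incHead-composition 0 ws))

map-composition-true : ∀ ws →
  map (composition 0) (map (true ∷_) ws) ≡ map (1 ∷_) (map (composition 0) ws)
map-composition-true ws = trans (sym (List.map-∘ ws)) (List.map-∘ ws)

compositions-words : ∀ n r → compositions (suc n) (suc r) ≡ map (composition 0) (words n r)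
compositions-words zero    zero          = refl
compositions-words zero    (suc zero)    = refl
compositions-words zero    (suc (suc r)) = refl
compositions-words (suc n) zero          =
  trans (cong (map incHead) (compositions-words n zero))
        (sym (map-composition-false (words n zero)))
compositions-words (suc n) (suc r) = begin
  compositions (suc (suc n)) (suc (suc r))
    ≡⟨ compositions-suc (suc n) (suc r) ⟩
  map incHead (compositions (suc n) (suc (suc r))) ++ map (1 ∷_) (compositions (suc n) (suc r))
    ≡⟨ cong₂ (λ cs cs′ → map incHead cs ++ map (1 ∷_) cs′)
             (compositions-words n (suc r)) (compositions-words n r) ⟩
  map incHead (map (composition 0) (words n (suc r)))
    ++ map (1 ∷_) (map (composition 0) (words n r))
    ≡⟨ cong₂ _++_ (map-composition-false (words n (suc r))) (map-composition-true (words n r)) ⟨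
  map (composition 0) (map (false ∷_) (words n (suc r)))
    ++ map (composition 0) (map (true ∷_) (words n r))
    ≡⟨ List.map-++ (composition 0) (map (false ∷_) (words n (suc r))) _ ⟨
  map (composition 0) (words (suc n) (suc r)) ∎

firstAtLeast2-composition : ∀ x w → T (firstAtLeast2 (composition (suc x) w))
firstAtLeast2-composition x []          = _
firstAtLeast2-composition x (false ∷ w) = firstAtLeast2-composition (suc x) w
firstAtLeast2-composition x (true ∷ w)  = _

Alist-words : ∀ n r → Alist (suc n) (suc r) ≡ map (composition 1) (words n r)
Alist-words n r = begin
  filter P? (compositions (suc (suc n)) (suc r))
    ≡⟨ cong (filter P?) (compositions-suc (suc n) r) ⟩
  filter P? (map incHead (compositions (suc n) (suc r)) ++ map (1 ∷_) (compositions (suc n) r))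
    ≡⟨ cong (λ cs → filter P? (cs ++ map (1 ∷_) (compositions (suc n) r)))
            (trans (cong (map incHead) (compositions-words n r))
                   (map-incHead-composition 0 (words n r))) ⟩
  filter P? (map (composition 1) (words n r) ++ map (1 ∷_) (compositions (suc n) r))
    ≡⟨ List.filter-++ P? (map (composition 1) (words n r)) _ ⟩
  filter P? (map (composition 1) (words n r)) ++ filter P? (map (1 ∷_) (compositions (suc n) r))
    ≡⟨ cong₂ _++_
         (List.filter-all P? (All.map⁺ (All.universal (firstAtLeast2-composition 0) (words n r))))
         (List.filter-none P? (All.map⁺ (All.universal (λ _ ()) (compositions (suc n) r)))) ⟩
  map (composition 1) (words n r) ++ []
    ≡⟨ List.++-identityʳ _ ⟩
  map (composition 1) (words n r) ∎
  where
  P? : Decidable (T ∘ firstAtLeast2)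
  P? c = T? (firstAtLeast2 c)

∸-mirror-bounds : ∀ {N x} → 1 ≤ x → x ≤ N → 1 ≤ suc N ∸ x × suc N ∸ x ≤ N
∸-mirror-bounds {N} {suc x} _ x<1+N = ℕP.m<n⇒0<n∸m (s≤s x<1+N) , ℕP.m∸n≤m N x

module _ {A : Set} {d : A} where

  nth1-All : ∀ {P : A → Set} {xs p} → All P xs → 1 ≤ p → p ≤ length xs → P (nth1 d xs p)
  nth1-All {xs = _ ∷ _} {suc zero}    (px ∷ _)   _ _         = px
  nth1-All {xs = _ ∷ _} {suc (suc p)} (_ ∷ pxs) _ (s≤s p≤) = nth1-All pxs (s≤s z≤n) p≤

  nth1-map : ∀ {B : Set} {d′ : B} (f : B → A) xs {p} → 1 ≤ p → p ≤ length xs →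
    nth1 d (map f xs) p ≡ f (nth1 d′ xs p)
  nth1-map f (x ∷ xs) {suc zero}    _ _        = refl
  nth1-map f (x ∷ xs) {suc (suc p)} _ (s≤s p≤) = nth1-map f xs (s≤s z≤n) p≤

  nth1-++ˡ : ∀ xs ys {p} → 1 ≤ p → p ≤ length xs → nth1 d (xs ++ ys) p ≡ nth1 d xs p
  nth1-++ˡ (x ∷ xs) ys {suc zero}    _ _        = refl
  nth1-++ˡ (x ∷ xs) ys {suc (suc p)} _ (s≤s p≤) = nth1-++ˡ xs ys (s≤s z≤n) p≤

  nth1-∷ʳ : ∀ xs x → nth1 d (xs ∷ʳ x) (suc (length xs)) ≡ x
  nth1-∷ʳ []       x = refl
  nth1-∷ʳ (_ ∷ xs) x = nth1-∷ʳ xs x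

  nth1-reverse : ∀ xs {q} → 1 ≤ q → q ≤ length xs →
    nth1 d (reverse xs) (suc (length xs) ∸ q) ≡ nth1 d xs q
  nth1-reverse (x ∷ xs) {suc zero} _ _ rewrite List.unfold-reverse x xs =
    trans (cong (nth1 d (reverse xs ∷ʳ x) ∘ suc) (sym (List.length-reverse xs)))
          (nth1-∷ʳ (reverse xs) x)
  nth1-reverse (x ∷ xs) {suc (suc q)} _ (s≤s q<) rewrite List.unfold-reverse x xs =
    trans (nth1-++ˡ (reverse xs) (x ∷ []) 1≤ ≤length) (nth1-reverse xs (s≤s z≤n) q<)
    where
    1≤ : 1 ≤ length xs ∸ q
    1≤ = proj₁ (∸-mirror-bounds (s≤s z≤n) q<)
    ≤length : length xs ∸ q ≤ length (reverse xs)
    ≤length = subst (length xs ∸ q ≤_) (sym (List.length-reverse xs))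
                    (proj₂ (∸-mirror-bounds (s≤s z≤n) q<))

indicator : Bool → ℕ
indicator b = if b then 1 else 0

t≡indicator : ∀ k i p q →
  t k i p q ≡ indicator (allPartialPos 0ℤ (nth1 [] (Alist k i) p) (nth1 [] (Blist k i) q))
t≡indicator k i p q with allPartialPos 0ℤ (nth1 [] (Alist k i) p) (nth1 [] (Blist k i) q)
... | true  = refl
... | false = refl

t≡indicator-dominated : ∀ n r p q → 1 ≤ p → p ≤ n C r → 1 ≤ q → q ≤ n C r →
  t (suc n) (suc r) p q ≡ indicator (dominated 0 (nth1 [] (words n r) p) (nth1 [] (words n r) q))
t≡indicator-dominated n r p q 1≤p p≤N 1≤q q≤N = begin
  t (suc n) (suc r) p q
    ≡⟨ t≡indicator (suc n) (suc r) p q ⟩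
  indicator (allPartialPos 0ℤ (nth1 [] (Alist (suc n) (suc r)) p)
                              (nth1 [] (compositions (suc n) (suc r)) q))
    ≡⟨ cong₂ (λ as bs → indicator (allPartialPos 0ℤ (nth1 [] as p) (nth1 [] bs q)))
             (Alist-words n r) (compositions-words n r) ⟩
  indicator (allPartialPos 0ℤ (nth1 [] (map (composition 1) W) p)
                              (nth1 [] (map (composition 0) W) q))
    ≡⟨ cong₂ (λ a b → indicator (allPartialPos 0ℤ a b))
             (nth1-map (composition 1) W 1≤p (inRange p≤N))
             (nth1-map (composition 0) W 1≤q (inRange q≤N)) ⟩
  indicator (allPartialPos 0ℤ (composition 1 (nth1 [] W p)) (composition 0 (nth1 [] W q)))
    ≡⟨ cong indicator (allPartialPos-composition≡dominated (nth1 [] W p) (nth1 [] W q)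
                         (trans (length≡n 1≤p p≤N) (sym (length≡n 1≤q q≤N)))) ⟩
  indicator (dominated 0 (nth1 [] W p) (nth1 [] W q)) ∎
  where
  W : List (List Bool)
  W = words n r
  inRange : ∀ {x} → x ≤ n C r → x ≤ length W
  inRange = subst (_ ≤_) (sym (length-words n r))
  length≡n : ∀ {x} → 1 ≤ x → x ≤ n C r → length (nth1 [] W x) ≡ n
  length≡n 1≤x x≤N = nth1-All (length-∈-words n r) 1≤x (inRange x≤N)

nth1-words-∸ : ∀ n r {x} → r ≤ n → 1 ≤ x → x ≤ n C r →
  nth1 [] (words n (n ∸ r)) (suc (n C r) ∸ x) ≡ complement (nth1 [] (words n r) x)
nth1-words-∸ n r {x} r≤n 1≤x x≤N = begin
  nth1 [] (words n (n ∸ r)) (suc (n C r) ∸ x)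
    ≡⟨ cong₂ (λ ws N → nth1 [] ws (suc N ∸ x)) (mirror-words n r r≤n) length-complement ⟨
  nth1 [] (reverse (map complement W)) (suc (length (map complement W)) ∸ x)
    ≡⟨ nth1-reverse (map complement W) 1≤x (subst (x ≤_) (sym length-complement) x≤N) ⟩
  nth1 [] (map complement W) x
    ≡⟨ nth1-map complement W 1≤x (subst (x ≤_) (sym (length-words n r)) x≤N) ⟩
  complement (nth1 [] W x) ∎
  where
  W : List (List Bool)
  W = words n r
  length-complement : length (map complement W) ≡ n C r
  length-complement = trans (List.length-map complement W) (length-words n r)

AntiTranspose : ℕ → (ℕ → ℕ → ℕ) → (ℕ → ℕ → ℕ) → Set
AntiTranspose N T S = ∀ p q → 1 ≤ p → p ≤ N → 1 ≤ q → q ≤ N → T p q ≡ S (suc N ∸ q) (suc N ∸ p)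

t-antiTranspose-words : ∀ n r → r ≤ n →
  AntiTranspose (n C r) (t (suc n) (suc r)) (t (suc n) (suc (n ∸ r)))
t-antiTranspose-words n r r≤n p q 1≤p p≤N 1≤q q≤N = begin
  t (suc n) (suc r) p q
    ≡⟨ t≡indicator-dominated n r p q 1≤p p≤N 1≤q q≤N ⟩
  indicator (dominated 0 (w p) (w q))
    ≡⟨ cong indicator (dominated-complement 0 (w p) (w q)) ⟩
  indicator (dominated 0 (complement (w q)) (complement (w p)))
    ≡⟨ cong₂ (λ u v → indicator (dominated 0 u v))
             (nth1-words-∸ n r r≤n 1≤q q≤N) (nth1-words-∸ n r r≤n 1≤p p≤N) ⟨
  indicator (dominated 0 (w′ (suc N ∸ q)) (w′ (suc N ∸ p)))
    ≡⟨ t≡indicator-dominated n (n ∸ r) (suc N ∸ q) (suc N ∸ p) 1≤q′ q′≤N′ 1≤p′ p′≤N′ ⟨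
  t (suc n) (suc (n ∸ r)) (suc N ∸ q) (suc N ∸ p) ∎
  where
  N : ℕ
  N = n C r
  w w′ : ℕ → List Bool
  w  = nth1 [] (words n r)
  w′ = nth1 [] (words n (n ∸ r))
  1≤q′ : 1 ≤ suc N ∸ q
  1≤q′ = proj₁ (∸-mirror-bounds 1≤q q≤N)
  1≤p′ : 1 ≤ suc N ∸ p
  1≤p′ = proj₁ (∸-mirror-bounds 1≤p p≤N)
  q′≤N′ : suc N ∸ q ≤ n C (n ∸ r)
  q′≤N′ = subst (suc N ∸ q ≤_) (nCk≡nC[n∸k] r≤n) (proj₂ (∸-mirror-bounds 1≤q q≤N))
  p′≤N′ : suc N ∸ p ≤ n C (n ∸ r)
  p′≤N′ = subst (suc N ∸ p ≤_) (nCk≡nC[n∸k] r≤n) (proj₂ (∸-mirror-bounds 1≤p p≤N))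

t-antiTranspose : ∀ k ℓ → 1 ≤ ℓ → ℓ ≤ k →
  AntiTranspose ((k ∸ 1) C (ℓ ∸ 1)) (t k ℓ) (t k (suc k ∸ ℓ))
t-antiTranspose (suc n) (suc r) _ (s≤s r≤n) rewrite ℕP.+-∸-assoc 1 r≤n =
  t-antiTranspose-words n r r≤n

t-antiSymmetric : ∀ k ℓ → ℓ + ℓ ≡ suc k → AntiTranspose ((k ∸ 1) C (ℓ ∸ 1)) (t k ℓ) (t k ℓ)
t-antiSymmetric k (suc r) ℓ+ℓ≡1+k =
  subst (λ j → AntiTranspose ((k ∸ 1) C r) (t k (suc r)) (t k j)) 1+k∸ℓ≡ℓ
        (t-antiTranspose k (suc r) (s≤s z≤n) ℓ≤k)
  where
  1+k∸ℓ≡ℓ : suc k ∸ suc r ≡ suc r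
  1+k∸ℓ≡ℓ = trans (cong (_∸ suc r) (sym ℓ+ℓ≡1+k)) (ℕP.m+n∸n≡m (suc r) (suc r))
  ℓ≤k : suc r ≤ k
  ℓ≤k = subst (suc r ≤_) (ℕP.suc-injective ℓ+ℓ≡1+k) (ℕP.m≤n+m (suc r) r)

corollary5 : (k : ℕ) → 1 < k →
    ((ℓ : ℕ) → 1 ≤ ℓ → ℓ ≤ k →
      (p q : ℕ) → 1 ≤ p → p ≤ (k ∸ 1) C (ℓ ∸ 1) → 1 ≤ q → q ≤ (k ∸ 1) C (ℓ ∸ 1) →
        t k ℓ p q ≡ t k (suc k ∸ ℓ) (suc ((k ∸ 1) C (ℓ ∸ 1)) ∸ q) (suc ((k ∸ 1) C (ℓ ∸ 1)) ∸ p))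
    × ((ℓ m : ℕ) → ℓ + ℓ ≡ suc k → ℓ ≡ 2 * m →
      (p q : ℕ) → 1 ≤ p → p ≤ (k ∸ 1) C (ℓ ∸ 1) → 1 ≤ q → q ≤ (k ∸ 1) C (ℓ ∸ 1) →
        t k ℓ p q ≡ t k ℓ (suc ((k ∸ 1) C (ℓ ∸ 1)) ∸ q) (suc ((k ∸ 1) C (ℓ ∸ 1)) ∸ p))
corollary5 k _ = t-antiTranspose k , λ ℓ _ ℓ+ℓ≡1+k _ → t-antiSymmetric k ℓ ℓ+ℓ≡1+k
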